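{- Let $a$ be an integer with $a\notin\{0,1,-1\}$, and let $p$ be an odd prime with $p\nmid 3a(a^3+1)$. Let $\{u_n\}_{n\geq0}$ be the Lucas sequence defined by $u_0=0$, $u_1=1$, $u_{n+1}=(2-a)u_n-(a^2-a+1)u_{n-1}$ for $n\geq1$. For an integer $r$ put $K_{p,3,r}(a)=\sum_{1\le k\le p-1,\ k\equiv r \ (\mathrm{mod}\ 3)}\frac{(-a)^k}{k}$. Then: (1) if $p\equiv1\pmod 3$, $$\frac{u_{p-1}}{p}\equiv\frac{(2a-1)K_{p,3,0}(a)+(a-2)K_{p,3,1}(a)}{a(a^2-a+1)}-\frac{a-2}{a^2-a+1}q_p(a)+\frac{a^2-1}{a(a^2-a+1)}q_p(a+1)\pmod p;$$ (2) if $p\equiv2\pmod 3$, $$\frac{u_{p+1}}{p}\equiv\frac{(a-2)K_{p,3,1}(a)-(a+1)K_{p,3,0}(a)}{a}-\frac{a+1}{a}q_p(a+1)\pmod p.$$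
   Context: For an odd prime $p$ and an integer $x$ with $p\nmid x$, the Fermat quotient is $q_p(x)=\frac{x^{p-1}-1}{p}$. Congruences modulo $p$ between rational numbers whose denominators are prime to $p$ are understood in the usual sense (in the ring of $p$-integral rationals); in particular $u_{p\mp1}/p$ is an integer in the respective cases. -}

module Defs where

open import Data.Nat as ℕ using (ℕ; zero; suc; _%_)
open import Data.Nat.Divisibility as ℕD using ()
import Data.Integer.Divisibility as ℤD
open import Data.Integer as ℤ using (ℤ; +_)
open import Data.Rational as ℚ using (ℚ; 0ℚ; 1ℚ; _+_; _-_; _*_; _÷_; ↥_; ↧ₙ_)
open import Data.Rational.Properties using (_≟_)
open import Data.List using (List; []; _∷_; upTo)
open import Data.Product using (_×_)
open import Relation.Binary.PropositionalEquality using (_≡_)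
open import Relation.Nullary using (¬_; yes; no)

ι : ℤ → ℚ
ι z = z ℚ./ 1

-- total division on ℚ (x / 0 := 0); only used with nonzero divisors below
_⊘_ : ℚ → ℚ → ℚ
x ⊘ y with y ≟ 0ℚ
... | yes _ = 0ℚ
... | no y≢0 = _÷_ x y {{ℚ.≢-nonZero y≢0}}

-- congruence modulo p in the ring of p-integral rationals:
-- x - y lies in p ℤ_(p), i.e. (in lowest terms) p divides the numerator
-- and p does not divide the denominator.
_≡_[modℚ_] : ℚ → ℚ → ℕ → Set
x ≡ y [modℚ p ] = (+ p ℤD.∣ (↥ (x - y))) × ¬ (p ℕD.∣ (↧ₙ (x - y)))

u : ℤ → ℕ → ℤ
u a zero = + 0
u a (suc zero) = + 1
u a (suc (suc n)) = (+ 2 ℤ.- a) ℤ.* u a (suc n) ℤ.- (a ℤ.* a ℤ.- a ℤ.+ + 1) ℤ.* u a n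

q : ℕ → ℤ → ℚ
q p x = ι (x ℤ.^ (p ℕ.∸ 1) ℤ.- + 1) ⊘ ι (+ p)

sumℚ : List ℚ → ℚ
sumℚ [] = 0ℚ
sumℚ (x ∷ xs) = x + sumℚ xs

Kterm : ℤ → ℕ → ℕ → ℚ
Kterm a r k with k % 3 ℕ.≟ r % 3
... | yes _ = ι ((ℤ.- a) ℤ.^ k) ⊘ ι (+ k)
... | no _ = 0ℚ

K : ℕ → ℕ → ℤ → ℚ
K p r a = sumℚ (Data.List.map (λ i → Kterm a r (suc i)) (upTo (p ℕ.∸ 1)))
  where import Data.List

{-# OPTIONS --safe #-}
-- Write Sᵣ(n) = Σ_{k ≡ r (mod 3)} C(n,k) aᵏ. Pascal's rule gives Sᵣ(n+1) = Sᵣ(n) + a·Sᵣ₋₁(n), from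
-- which a·uₙ = S₁(n) − S₂(n) and S₀(n) + S₁(n) + S₂(n) = (1+a)ⁿ; hence a·u_{p±1} and
-- a(a²−a+1)·u_{p−1} are explicit combinations of S₀(p), S₁(p) and (1+a)^{p−1}. On the other hand
-- k·C(p,k) = p·C(p−1,k−1) and C(p−1,k−1) ≡ (−1)^{k−1} (mod p) give C(p,k)·aᵏ + p(−a)ᵏ/k ≡ 0 (mod p²)
-- for 0 < k < p, so Sᵣ(p) + p·K_{p,3,r}(a) ≡ [r ≡ 0] + [p ≡ r]·aᵖ (mod p²). Substituting these two
-- congruences and dividing by p (and by the unit a or a(a²−a+1)) yields both formulas.
module Submission where

open import Defs
open import Algebra.Bundles using (CommutativeRing)
open import Data.Empty using (⊥-elim)
open import Data.Fin as Fin using (Fin; toℕ)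
import Data.Fin.Properties as FinP
open import Data.Integer as ℤ using (ℤ; +_; -[1+_])
import Data.Integer.Properties as ℤP
open import Data.Integer.Divisibility using (_∣_)
import Data.Integer.Divisibility.Signed as ℤS
open import Data.Integer.Tactic.RingSolver using () renaming (solve to ℤ-solve; solve-∀ to ℤ-solve-∀)
open import Data.List using (_∷_; []; map; applyUpTo)
open import Data.Nat as ℕ using (ℕ; zero; suc; _%_)
open import Data.Nat.Combinatorics using (_C_; nC1≡n; nCn≡1; k>n⇒nCk≡0; nCk+nC[k+1]≡[n+1]C[k+1])
import Data.Nat.Coprimality as Coprimality
import Data.Nat.DivMod as ℕDM
import Data.Nat.Divisibility as ℕD
open import Data.Nat.Primality using (Prime; euclidsLemma; ¬prime[0]; ¬prime[1])
import Data.Nat.Properties as ℕP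
open import Data.Nat.Tactic.RingSolver using () renaming (solve-∀ to ℕ-solve-∀)
open import Data.Product using (_×_; _,_; proj₁; proj₂)
open import Data.Rational as ℚ using (ℚ; _+_; _-_; _*_; 0ℚ; 1ℚ; ↥_; ↧ₙ_; 1/_)
import Data.Rational.Properties as ℚP
import Data.Rational.Unnormalised as ℚᵘ
import Data.Rational.Unnormalised.Properties as ℚᵘP
open import Data.Sum using (inj₁; inj₂)
open import Function using (_∋_)
open import Level using (0ℓ)
open import Relation.Binary.PropositionalEquality
open import Relation.Nullary using (¬_; yes; no)
open import Relation.Nullary.Decidable using (dec⇒maybe)
open import Tactic.RingSolver using (solve-∀; solve)
open import Tactic.RingSolver.Core.AlmostCommutativeRing using (AlmostCommutativeRing; fromCommutativeRing)

open import Algebra.Properties.Semiring.Sum (CommutativeRing.semiring ℚP.+-*-commutativeRing)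
  using (sum; sum-syntax; sum-cong-≗; ∑-distrib-+; *-distribˡ-sum; sum-init-last)

-- The solver needs the decidable zero test to discard coefficients that cancel.
ℚ-ring : AlmostCommutativeRing 0ℓ 0ℓ
ℚ-ring = fromCommutativeRing ℚP.+-*-commutativeRing (λ x → dec⇒maybe (0ℚ ℚP.≟ x))

ι-toℚᵘ : ∀ z → ℚ.toℚᵘ (ι z) ℚᵘ.≃ ℚᵘ.mkℚᵘ z 0
ι-toℚᵘ z = ℚP.toℚᵘ-fromℚᵘ (ℚᵘ.mkℚᵘ z 0)

ι-injective : ∀ {m n} → ι m ≡ ι n → m ≡ n
ι-injective {m} {n} ιm≡ιn = begin
  m          ≡⟨ ℤP.*-identityʳ m ⟨
  m ℤ.* + 1  ≡⟨ ℚᵘP.drop-*≡* (ℚᵘP.≃-trans (ℚᵘP.≃-sym (ι-toℚᵘ m)) (ℚᵘP.≃-trans (ℚP.toℚᵘ-cong ιm≡ιn) (ι-toℚᵘ n))) ⟩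
  n ℤ.* + 1  ≡⟨ ℤP.*-identityʳ n ⟩
  n          ∎
  where open ≡-Reasoning

ι-+ : ∀ m n → ι (m ℤ.+ n) ≡ ι m + ι n
ι-+ m n = ℚP.toℚᵘ-injective (begin
  ℚ.toℚᵘ (ι (m ℤ.+ n))              ≈⟨ ι-toℚᵘ (m ℤ.+ n) ⟩
  ℚᵘ.mkℚᵘ (m ℤ.+ n) 0               ≈⟨ ℚᵘ.*≡* (((m ℤ.+ n) ℤ.* + 1 ≡ (m ℤ.* + 1 ℤ.+ n ℤ.* + 1) ℤ.* + 1) ∋ ℤ-solve (m ∷ n ∷ [])) ⟩
  ℚᵘ.mkℚᵘ m 0 ℚᵘ.+ ℚᵘ.mkℚᵘ n 0      ≈⟨ ℚᵘP.+-cong (ℚᵘP.≃-sym (ι-toℚᵘ m)) (ℚᵘP.≃-sym (ι-toℚᵘ n)) ⟩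
  ℚ.toℚᵘ (ι m) ℚᵘ.+ ℚ.toℚᵘ (ι n)    ≈⟨ ℚᵘP.≃-sym (ℚP.toℚᵘ-homo-+ (ι m) (ι n)) ⟩
  ℚ.toℚᵘ (ι m + ι n)                ∎)
  where open ℚᵘP.≃-Reasoning

ι-* : ∀ m n → ι (m ℤ.* n) ≡ ι m * ι n
ι-* m n = ℚP.toℚᵘ-injective (begin
  ℚ.toℚᵘ (ι (m ℤ.* n))              ≈⟨ ι-toℚᵘ (m ℤ.* n) ⟩
  ℚᵘ.mkℚᵘ (m ℤ.* n) 0               ≈⟨ ℚᵘ.*≡* refl ⟩
  ℚᵘ.mkℚᵘ m 0 ℚᵘ.* ℚᵘ.mkℚᵘ n 0      ≈⟨ ℚᵘP.*-cong (ℚᵘP.≃-sym (ι-toℚᵘ m)) (ℚᵘP.≃-sym (ι-toℚᵘ n)) ⟩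
  ℚ.toℚᵘ (ι m) ℚᵘ.* ℚ.toℚᵘ (ι n)    ≈⟨ ℚᵘP.≃-sym (ℚP.toℚᵘ-homo-* (ι m) (ι n)) ⟩
  ℚ.toℚᵘ (ι m * ι n)                ∎)
  where open ℚᵘP.≃-Reasoning

ι-neg : ∀ m → ι (ℤ.- m) ≡ ℚ.- ι m
ι-neg m = ℚP.toℚᵘ-injective (begin
  ℚ.toℚᵘ (ι (ℤ.- m))     ≈⟨ ι-toℚᵘ (ℤ.- m) ⟩
  ℚᵘ.- ℚᵘ.mkℚᵘ m 0       ≈⟨ ℚᵘP.-‿cong (ℚᵘP.≃-sym (ι-toℚᵘ m)) ⟩
  ℚᵘ.- ℚ.toℚᵘ (ι m)      ≈⟨ ℚᵘP.≃-sym (ℚP.toℚᵘ-homo‿- (ι m)) ⟩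
  ℚ.toℚᵘ (ℚ.- ι m)       ∎)
  where open ℚᵘP.≃-Reasoning

ι-- : ∀ m n → ι (m ℤ.- n) ≡ ι m - ι n
ι-- m n = trans (ι-+ m (ℤ.- n)) (cong (λ t → ι m + t) (ι-neg n))

ι≢0 : ∀ {p} m → ¬ (+ p ∣ m) → ι m ≢ 0ℚ
ι≢0 {p} m p∤m ιm≡0 = p∤m (subst (+ p ∣_) (sym (ι-injective {m} {+ 0} ιm≡0)) (p ℕD.∣0))

cross-multiply : ∀ num den .{coprime : Coprimality.Coprime ℤ.∣ num ∣ (suc den)} d m →
                 ℚ.mkℚ num den coprime * ι d ≡ ι m → num ℤ.* d ≡ m ℤ.* + suc den
cross-multiply num den {coprime} d m w*ιd≡ιm =
  trans (sym (ℤP.*-identityʳ (num ℤ.* d)))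
        (trans (ℚᵘP.drop-*≡* cross) (cong (λ k → m ℤ.* + k) (ℕP.*-identityʳ (suc den))))
  where
  open ℚᵘP.≃-Reasoning
  w : ℚ
  w = ℚ.mkℚ num den coprime
  cross : ℚᵘ.mkℚᵘ num den ℚᵘ.* ℚᵘ.mkℚᵘ d 0 ℚᵘ.≃ ℚᵘ.mkℚᵘ m 0
  cross = begin
    ℚᵘ.mkℚᵘ num den ℚᵘ.* ℚᵘ.mkℚᵘ d 0   ≈⟨ ℚᵘP.*-congˡ {ℚᵘ.mkℚᵘ num den} (ℚᵘP.≃-sym (ι-toℚᵘ d)) ⟩
    ℚ.toℚᵘ w ℚᵘ.* ℚ.toℚᵘ (ι d)          ≈⟨ ℚᵘP.≃-sym (ℚP.toℚᵘ-homo-* w (ι d)) ⟩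
    ℚ.toℚᵘ (w * ι d)                    ≈⟨ ℚP.toℚᵘ-cong w*ιd≡ιm ⟩
    ℚ.toℚᵘ (ι m)                        ≈⟨ ι-toℚᵘ m ⟩
    ℚᵘ.mkℚᵘ m 0                         ∎

x⊘y*y≡x : ∀ x {y} → y ≢ 0ℚ → (x ⊘ y) * y ≡ x
x⊘y*y≡x x {y} y≢0 with y ℚP.≟ 0ℚ
... | yes y≡0 = ⊥-elim (y≢0 y≡0)
... | no y≢0′ = begin
  x * 1/ y * y     ≡⟨ ℚP.*-assoc x (1/ y) y ⟩
  x * (1/ y * y)   ≡⟨ cong (x *_) (ℚP.*-inverseˡ y) ⟩
  x * 1ℚ           ≡⟨ ℚP.*-identityʳ x ⟩
  x                ∎
  where
  open ≡-Reasoning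
  instance _ = ℚ.≢-nonZero y≢0′

*-cancelʳ-≡ : ∀ x y {k} → k ≢ 0ℚ → x * k ≡ y * k → x ≡ y
*-cancelʳ-≡ x y {k} k≢0 xk≡yk = begin
  x                ≡⟨ unfold x ⟩
  x * k * 1/ k     ≡⟨ cong (_* 1/ k) xk≡yk ⟩
  y * k * 1/ k     ≡⟨ unfold y ⟨
  y                ∎
  where
  open ≡-Reasoning
  instance _ = ℚ.≢-nonZero k≢0
  unfold : ∀ z → z ≡ z * k * 1/ k
  unfold z = begin
    z                ≡⟨ ℚP.*-identityʳ z ⟨
    z * 1ℚ           ≡⟨ cong (z *_) (ℚP.*-inverseʳ k) ⟨
    z * (k * 1/ k)   ≡⟨ ℚP.*-assoc z k (1/ k) ⟨
    z * k * 1/ k     ∎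

cancel-vanishing : ∀ {x y z w} → z ≡ w → x ≡ y + (z - w) → x ≡ y
cancel-vanishing {x} {y} {z} refl x≡y+[z-z] = begin
  x              ≡⟨ x≡y+[z-z] ⟩
  y + (z - z)    ≡⟨ cong (λ t → y + t) (ℚP.+-inverseʳ z) ⟩
  y + 0ℚ         ≡⟨ ℚP.+-identityʳ y ⟩
  y              ∎
  where open ≡-Reasoning

-- Divisibility in the local ring ℤ₍ₚ₎

record _∣⟨_⟩_ (c : ℚ) (p : ℕ) (x : ℚ) : Set where
  constructor fraction
  field
    numerator denominator : ℤ
    p∤denominator : ¬ (+ p ∣ denominator)
    x*d≡c*n : x * ι denominator ≡ c * ι numerator

∣⟨⟩-cancelʳ : ∀ {p c x k} → k ≢ 0ℚ → (c * k) ∣⟨ p ⟩ (x * k) → c ∣⟨ p ⟩ x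
∣⟨⟩-cancelʳ {p} {c} {x} {k} k≢0 (fraction n d p∤d xk*d≡ck*n) =
  fraction n d p∤d (*-cancelʳ-≡ (x * ι d) (c * ι n) k≢0 (begin
    x * ι d * k    ≡⟨ swap x (ι d) k ⟩
    x * k * ι d    ≡⟨ xk*d≡ck*n ⟩
    c * k * ι n    ≡⟨ swap c k (ι n) ⟩
    c * ι n * k    ∎))
  where
  open ≡-Reasoning
  swap : ∀ u v w → u * v * w ≡ u * w * v
  swap = solve-∀ ℚ-ring

module _ {p : ℕ} (p-prime : Prime p) where

  p∤1 : ¬ (p ℕD.∣ 1)
  p∤1 p∣1 = ¬prime[1] (subst Prime (ℕD.∣1⇒≡1 p∣1) p-prime)

  p∤m*n : ∀ m n → ¬ (+ p ∣ m) → ¬ (+ p ∣ n) → ¬ (+ p ∣ m ℤ.* n)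
  p∤m*n m n p∤m p∤n p∣mn with euclidsLemma ℤ.∣ m ∣ ℤ.∣ n ∣ p-prime (subst (p ℕD.∣_) (ℤP.abs-* m n) p∣mn)
  ... | inj₁ p∣m = p∤m p∣m
  ... | inj₂ p∣n = p∤n p∣n

  ∣⟨⟩-zero : ∀ {c} → c ∣⟨ p ⟩ 0ℚ
  ∣⟨⟩-zero {c} = fraction (+ 0) (+ 1) p∤1 (sym (ℚP.*-zeroʳ c))

  1∣⟨⟩ι : ∀ n → 1ℚ ∣⟨ p ⟩ ι n
  1∣⟨⟩ι n = fraction n (+ 1) p∤1 (trans (ℚP.*-identityʳ (ι n)) (sym (ℚP.*-identityˡ (ι n))))

  ∣⟨⟩-+ : ∀ {c x y} → c ∣⟨ p ⟩ x → c ∣⟨ p ⟩ y → c ∣⟨ p ⟩ (x + y)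
  ∣⟨⟩-+ {c} {x} {y} (fraction n₁ d₁ p∤d₁ eq₁) (fraction n₂ d₂ p∤d₂ eq₂) =
    fraction (n₁ ℤ.* d₂ ℤ.+ n₂ ℤ.* d₁) (d₁ ℤ.* d₂) (p∤m*n d₁ d₂ p∤d₁ p∤d₂) (begin
      (x + y) * ι (d₁ ℤ.* d₂)                      ≡⟨ cong ((x + y) *_) (ι-* d₁ d₂) ⟩
      (x + y) * (ι d₁ * ι d₂)                      ≡⟨ expand x y (ι d₁) (ι d₂) ⟩
      x * ι d₁ * ι d₂ + y * ι d₂ * ι d₁            ≡⟨ cong₂ (λ s t → s * ι d₂ + t * ι d₁) eq₁ eq₂ ⟩
      c * ι n₁ * ι d₂ + c * ι n₂ * ι d₁            ≡⟨ collect c (ι n₁) (ι n₂) (ι d₁) (ι d₂) ⟩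
      c * (ι n₁ * ι d₂ + ι n₂ * ι d₁)              ≡⟨ cong (c *_) ι-numerator ⟨
      c * ι (n₁ ℤ.* d₂ ℤ.+ n₂ ℤ.* d₁)              ∎)
    where
    open ≡-Reasoning
    expand : ∀ x y D₁ D₂ → (x + y) * (D₁ * D₂) ≡ x * D₁ * D₂ + y * D₂ * D₁
    expand = solve-∀ ℚ-ring
    collect : ∀ c N₁ N₂ D₁ D₂ → c * N₁ * D₂ + c * N₂ * D₁ ≡ c * (N₁ * D₂ + N₂ * D₁)
    collect = solve-∀ ℚ-ring
    ι-numerator : ι (n₁ ℤ.* d₂ ℤ.+ n₂ ℤ.* d₁) ≡ ι n₁ * ι d₂ + ι n₂ * ι d₁
    ι-numerator = trans (ι-+ (n₁ ℤ.* d₂) (n₂ ℤ.* d₁)) (cong₂ _+_ (ι-* n₁ d₂) (ι-* n₂ d₁))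

  ∣⟨⟩-*ˡ : ∀ {c z x} → 1ℚ ∣⟨ p ⟩ z → c ∣⟨ p ⟩ x → c ∣⟨ p ⟩ (z * x)
  ∣⟨⟩-*ˡ {c} {z} {x} (fraction n₁ d₁ p∤d₁ eq₁) (fraction n₂ d₂ p∤d₂ eq₂) =
    fraction (n₁ ℤ.* n₂) (d₁ ℤ.* d₂) (p∤m*n d₁ d₂ p∤d₁ p∤d₂) (begin
      z * x * ι (d₁ ℤ.* d₂)             ≡⟨ cong (z * x *_) (ι-* d₁ d₂) ⟩
      z * x * (ι d₁ * ι d₂)             ≡⟨ regroup z x (ι d₁) (ι d₂) ⟩
      z * ι d₁ * (x * ι d₂)             ≡⟨ cong₂ _*_ eq₁ eq₂ ⟩
      1ℚ * ι n₁ * (c * ι n₂)            ≡⟨ collect c (ι n₁) (ι n₂) ⟩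
      c * (ι n₁ * ι n₂)                 ≡⟨ cong (c *_) (ι-* n₁ n₂) ⟨
      c * ι (n₁ ℤ.* n₂)                 ∎)
    where
    open ≡-Reasoning
    regroup : ∀ z x D₁ D₂ → z * x * (D₁ * D₂) ≡ z * D₁ * (x * D₂)
    regroup = solve-∀ ℚ-ring
    collect : ∀ c N₁ N₂ → 1ℚ * N₁ * (c * N₂) ≡ c * (N₁ * N₂)
    collect = solve-∀ ℚ-ring

  ∣⟨⟩-cancel-unitʳ : ∀ {c x} m → ¬ (+ p ∣ m) → c ∣⟨ p ⟩ (x * ι m) → c ∣⟨ p ⟩ x
  ∣⟨⟩-cancel-unitʳ {c} {x} m p∤m (fraction n d p∤d x*m*d≡c*n) =
    fraction n (m ℤ.* d) (p∤m*n m d p∤m p∤d) (begin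
      x * ι (m ℤ.* d)      ≡⟨ cong (x *_) (ι-* m d) ⟩
      x * (ι m * ι d)      ≡⟨ ℚP.*-assoc x (ι m) (ι d) ⟨
      x * ι m * ι d        ≡⟨ x*m*d≡c*n ⟩
      c * ι n              ∎)
    where open ≡-Reasoning

  ∣⟨⟩-sum : ∀ {c n} (f : Fin n → ℚ) → (∀ i → c ∣⟨ p ⟩ f i) → c ∣⟨ p ⟩ sum f
  ∣⟨⟩-sum {n = zero}  f c∣f = ∣⟨⟩-zero
  ∣⟨⟩-sum {n = suc n} f c∣f = ∣⟨⟩-+ (c∣f Fin.zero) (∣⟨⟩-sum (λ i → f (Fin.suc i)) (λ i → c∣f (Fin.suc i)))

  p∣⟨⟩⇒p∣↥∧p∤↧ : ∀ w → ι (+ p) ∣⟨ p ⟩ w → (+ p ∣ ↥ w) × ¬ (p ℕD.∣ ↧ₙ w)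
  p∣⟨⟩⇒p∣↥∧p∤↧ (ℚ.mkℚ num den coprime) (fraction n d p∤d w*d≡p*n) = p∣num , p∤den
    where
    p∣num*d : + p ∣ num ℤ.* d
    p∣num*d = ℤS.∣⇒∣ᵤ (ℤS.divides (n ℤ.* + suc den) (begin
      num ℤ.* d                   ≡⟨ cross-multiply num den d (+ p ℤ.* n) (trans w*d≡p*n (sym (ι-* (+ p) n))) ⟩
      + p ℤ.* n ℤ.* + suc den     ≡⟨ ℤP.*-assoc (+ p) n (+ suc den) ⟩
      + p ℤ.* (n ℤ.* + suc den)   ≡⟨ ℤP.*-comm (+ p) (n ℤ.* + suc den) ⟩
      n ℤ.* + suc den ℤ.* + p     ∎))
      where open ≡-Reasoning
    p∣num : + p ∣ num
    p∣num with euclidsLemma ℤ.∣ num ∣ ℤ.∣ d ∣ p-prime (subst (p ℕD.∣_) (ℤP.abs-* num d) p∣num*d)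
    ... | inj₁ p∣num = p∣num
    ... | inj₂ p∣d   = ⊥-elim (p∤d p∣d)
    p∤den : ¬ (p ℕD.∣ suc den)
    p∤den p∣den = ¬prime[1] (subst Prime (Coprimality.recompute coprime (p∣num , p∣den)) p-prime)

  ∣⟨⟩⇒≡[modℚ] : ∀ {x y} → ι (+ p) ∣⟨ p ⟩ (x - y) → x ≡ y [modℚ p ]
  ∣⟨⟩⇒≡[modℚ] {x} {y} = p∣⟨⟩⇒p∣↥∧p∤↧ (x - y)

∑-last : ∀ n (f : ℕ → ℚ) → ∑[ i < suc n ] f (toℕ i) ≡ ∑[ i < n ] f (toℕ i) + f n
∑-last n f = trans (sum-init-last {n} (λ i → f (toℕ i)))
  (cong₂ _+_ (sum-cong-≗ {n} {λ i → f (toℕ (Fin.inject₁ i))} (λ i → cong f (FinP.toℕ-inject₁ i)))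
             (cong f (FinP.toℕ-fromℕ n)))

sumℚ-map-applyUpTo : ∀ n (g : ℕ → ℚ) (f : ℕ → ℕ) → sumℚ (map g (applyUpTo f n)) ≡ ∑[ i < n ] g (f (toℕ i))
sumℚ-map-applyUpTo zero    g f = refl
sumℚ-map-applyUpTo (suc n) g f = cong (λ s → g (f 0) + s) (sumℚ-map-applyUpTo n g (λ i → f (suc i)))

%-cong-+ˡ : ∀ c {m n} d .{{_ : ℕ.NonZero d}} → m % d ≡ n % d → (c ℕ.+ m) % d ≡ (c ℕ.+ n) % d
%-cong-+ˡ c {m} {n} d m≡n = begin
  (c ℕ.+ m) % d              ≡⟨ ℕDM.%-distribˡ-+ c m d ⟩
  (c % d ℕ.+ m % d) % d      ≡⟨ cong (λ t → (c % d ℕ.+ t) % d) m≡n ⟩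
  (c % d ℕ.+ n % d) % d      ≡⟨ ℕDM.%-distribˡ-+ c n d ⟨
  (c ℕ.+ n) % d              ∎
  where open ≡-Reasoning

[3+n]%3≡n%3 : ∀ n → (3 ℕ.+ n) % 3 ≡ n % 3
[3+n]%3≡n%3 n = trans (ℕDM.%-distribˡ-+ 3 n 3) (ℕDM.m%n%n≡m%n n 3)

δ₃ : ℕ → ℕ → ℚ
δ₃ r k with k % 3 ℕ.≟ r % 3
... | yes _ = 1ℚ
... | no  _ = 0ℚ

δ₃-≡ : ∀ r k → k % 3 ≡ r % 3 → δ₃ r k ≡ 1ℚ
δ₃-≡ r k k≡r with k % 3 ℕ.≟ r % 3
... | yes _  = refl
... | no k≢r = ⊥-elim (k≢r k≡r)

δ₃-≢ : ∀ r k → k % 3 ≢ r % 3 → δ₃ r k ≡ 0ℚ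
δ₃-≢ r k k≢r with k % 3 ℕ.≟ r % 3
... | yes k≡r = ⊥-elim (k≢r k≡r)
... | no _    = refl

δ₃-cong : ∀ {r r′} k → r % 3 ≡ r′ % 3 → δ₃ r k ≡ δ₃ r′ k
δ₃-cong {r} {r′} k r≡r′ with k % 3 ℕ.≟ r % 3
... | yes k≡r = sym (δ₃-≡ r′ k (trans k≡r r≡r′))
... | no k≢r  = sym (δ₃-≢ r′ k (λ k≡r′ → k≢r (trans k≡r′ (sym r≡r′))))

δ₃-suc : ∀ r k → δ₃ r (suc k) ≡ δ₃ (suc (suc r)) k
δ₃-suc r k with suc k % 3 ℕ.≟ r % 3 | k % 3 ℕ.≟ suc (suc r) % 3
... | yes _     | yes _     = refl
... | no _      | no _      = refl
... | yes 1+k≡r | no k≢2+r  = ⊥-elim (k≢2+r (trans (sym ([3+n]%3≡n%3 k)) (%-cong-+ˡ 2 {suc k} {r} 3 1+k≡r)))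
... | no 1+k≢r  | yes k≡2+r = ⊥-elim (1+k≢r (trans (%-cong-+ˡ 1 {k} {suc (suc r)} 3 k≡2+r) ([3+n]%3≡n%3 r)))

1∣⟨⟩δ₃ : ∀ {p} → Prime p → ∀ r k → 1ℚ ∣⟨ p ⟩ δ₃ r k
1∣⟨⟩δ₃ p-prime r k with k % 3 ℕ.≟ r % 3
... | yes _ = 1∣⟨⟩ι p-prime (+ 1)
... | no  _ = 1∣⟨⟩ι p-prime (+ 0)

Kterm≡δ₃* : ∀ a r k → Kterm a r k ≡ δ₃ r k * (ι ((ℤ.- a) ℤ.^ k) ⊘ ι (+ k))
Kterm≡δ₃* a r k with k % 3 ℕ.≟ r % 3
... | yes _ = sym (ℚP.*-identityˡ (ι ((ℤ.- a) ℤ.^ k) ⊘ ι (+ k)))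
... | no  _ = sym (ℚP.*-zeroˡ (ι ((ℤ.- a) ℤ.^ k) ⊘ ι (+ k)))

-- Binomial coefficients modulo p

pascal : ∀ n k → suc n C suc k ≡ n C k ℕ.+ n C suc k
pascal n k = sym (nCk+nC[k+1]≡[n+1]C[k+1] n k)

[1+k]*[1+n]C[1+k]≡[1+n]*nCk : ∀ n k → suc k ℕ.* (suc n C suc k) ≡ suc n ℕ.* (n C k)
[1+k]*[1+n]C[1+k]≡[1+n]*nCk n zero =
  trans (ℕP.+-identityʳ (suc n C 1)) (trans (nC1≡n (suc n)) (sym (ℕP.*-identityʳ (suc n))))
[1+k]*[1+n]C[1+k]≡[1+n]*nCk zero (suc k) = ℕP.*-zeroʳ (suc (suc k))
[1+k]*[1+n]C[1+k]≡[1+n]*nCk (suc n) (suc j) = begin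
  suc (suc j) ℕ.* (suc (suc n) C suc (suc j))
    ≡⟨ cong (suc (suc j) ℕ.*_) (pascal (suc n) (suc j)) ⟩
  suc (suc j) ℕ.* (suc n C suc j ℕ.+ suc n C suc (suc j))
    ≡⟨ split j (suc n C suc j) (suc n C suc (suc j)) ⟩
  suc j ℕ.* (suc n C suc j) ℕ.+ suc (suc j) ℕ.* (suc n C suc (suc j)) ℕ.+ suc n C suc j
    ≡⟨ cong₂ (λ s t → s ℕ.+ t ℕ.+ suc n C suc j)
             ([1+k]*[1+n]C[1+k]≡[1+n]*nCk n j) ([1+k]*[1+n]C[1+k]≡[1+n]*nCk n (suc j)) ⟩
  suc n ℕ.* (n C j) ℕ.+ suc n ℕ.* (n C suc j) ℕ.+ suc n C suc j
    ≡⟨ cong (ℕ._+ suc n C suc j) (ℕP.*-distribˡ-+ (suc n) (n C j) (n C suc j)) ⟨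
  suc n ℕ.* (n C j ℕ.+ n C suc j) ℕ.+ suc n C suc j
    ≡⟨ cong (λ c → suc n ℕ.* c ℕ.+ suc n C suc j) (pascal n j) ⟨
  suc n ℕ.* (suc n C suc j) ℕ.+ suc n C suc j
    ≡⟨ ℕP.+-comm (suc n ℕ.* (suc n C suc j)) (suc n C suc j) ⟩
  suc (suc n) ℕ.* (suc n C suc j)
    ∎
  where
  open ≡-Reasoning
  split : ∀ j x y → suc (suc j) ℕ.* (x ℕ.+ y) ≡ suc j ℕ.* x ℕ.+ suc (suc j) ℕ.* y ℕ.+ x
  split = ℕ-solve-∀

module _ {p′ : ℕ} (p-prime : Prime (suc p′)) where

  private
    p : ℕ
    p = suc p′

  p∤[1+k] : ∀ {k} → suc k ℕ.< p → ¬ (p ℕD.∣ suc k)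
  p∤[1+k] 1+k<p p∣1+k = ℕP.<⇒≱ 1+k<p (ℕD.∣⇒≤ p∣1+k)

  p∣pC[1+k] : ∀ {k} → suc k ℕ.< p → p ℕD.∣ p C suc k
  p∣pC[1+k] {k} 1+k<p with euclidsLemma (suc k) (p C suc k) p-prime
    (subst (p ℕD.∣_) (sym ([1+k]*[1+n]C[1+k]≡[1+n]*nCk p′ k)) (ℕD.m∣m*n (p′ C k)))
  ... | inj₁ p∣1+k      = ⊥-elim (p∤[1+k] 1+k<p p∣1+k)
  ... | inj₂ p∣pC[1+k]  = p∣pC[1+k]

  p∣[p-1]Cj*x^j-[-x]^j : ∀ x {j} → j ℕ.≤ p′ → + p ℤS.∣ + (p′ C j) ℤ.* x ℤ.^ j ℤ.- (ℤ.- x) ℤ.^ j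
  p∣[p-1]Cj*x^j-[-x]^j x {zero}  _     = ℤS.divides (+ 0) refl
  p∣[p-1]Cj*x^j-[-x]^j x {suc j} 1+j≤p′ =
    subst (+ p ℤS.∣_) (sym (regroup x (x ℤ.^ j) ((ℤ.- x) ℤ.^ j) (+ (p′ C j)) (+ (p′ C suc j))))
      (ℤS.∣n⇒∣m*n x (ℤS.∣m∣n⇒∣m-n (ℤS.∣m⇒∣m*n (x ℤ.^ j) p∣pC[1+j]) (p∣[p-1]Cj*x^j-[-x]^j x (ℕP.<⇒≤ 1+j≤p′))))
    where
    regroup : ∀ x y z b b′ → b′ ℤ.* (x ℤ.* y) ℤ.- (ℤ.- x) ℤ.* z ≡ x ℤ.* ((b ℤ.+ b′) ℤ.* y ℤ.- (b ℤ.* y ℤ.- z))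
    regroup = ℤ-solve-∀
    p∣pC[1+j] : + p ℤS.∣ + (p′ C j) ℤ.+ + (p′ C suc j)
    p∣pC[1+j] = ℤS.∣ᵤ⇒∣ (subst (p ℕD.∣_) (pascal p′ j) (p∣pC[1+k] (ℕ.s≤s 1+j≤p′)))

  p²∣k*pCk*a^k+p*[-a]^k : ∀ a {j} → j ℕ.< p′ →
    + p ℤ.* + p ℤS.∣ + (p C suc j) ℤ.* + suc j ℤ.* a ℤ.^ suc j ℤ.+ + p ℤ.* (ℤ.- a) ℤ.^ suc j
  p²∣k*pCk*a^k+p*[-a]^k a {j} j<p′ with p∣[p-1]Cj*x^j-[-x]^j a (ℕP.<⇒≤ j<p′)
  ... | ℤS.divides m C*a^j-[-a]^j≡m*p = ℤS.divides (a ℤ.* m) (begin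
    + (p C suc j) ℤ.* + suc j ℤ.* a ℤ.^ suc j ℤ.+ + p ℤ.* (ℤ.- a) ℤ.^ suc j
      ≡⟨ cong (λ b → b ℤ.* a ℤ.^ suc j ℤ.+ + p ℤ.* (ℤ.- a) ℤ.^ suc j) absorption ⟩
    + p ℤ.* + (p′ C j) ℤ.* (a ℤ.* a ℤ.^ j) ℤ.+ + p ℤ.* ((ℤ.- a) ℤ.* (ℤ.- a) ℤ.^ j)
      ≡⟨ factor (+ p) (+ (p′ C j)) a (a ℤ.^ j) ((ℤ.- a) ℤ.^ j) ⟩
    + p ℤ.* a ℤ.* (+ (p′ C j) ℤ.* a ℤ.^ j ℤ.- (ℤ.- a) ℤ.^ j)
      ≡⟨ cong (+ p ℤ.* a ℤ.*_) C*a^j-[-a]^j≡m*p ⟩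
    + p ℤ.* a ℤ.* (m ℤ.* + p)
      ≡⟨ regroup (+ p) a m ⟩
    a ℤ.* m ℤ.* (+ p ℤ.* + p) ∎)
    where
    open ≡-Reasoning
    absorption : + (p C suc j) ℤ.* + suc j ≡ + p ℤ.* + (p′ C j)
    absorption = begin
      + (p C suc j) ℤ.* + suc j    ≡⟨ ℤP.*-comm (+ (p C suc j)) (+ suc j) ⟩
      + suc j ℤ.* + (p C suc j)    ≡⟨ ℤP.pos-* (suc j) (p C suc j) ⟨
      + (suc j ℕ.* (p C suc j))    ≡⟨ cong +_ ([1+k]*[1+n]C[1+k]≡[1+n]*nCk p′ j) ⟩
      + (p ℕ.* (p′ C j))           ≡⟨ ℤP.pos-* p (p′ C j) ⟩
      + p ℤ.* + (p′ C j)           ∎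
    factor : ∀ P B a x y → P ℤ.* B ℤ.* (a ℤ.* x) ℤ.+ P ℤ.* ((ℤ.- a) ℤ.* y) ≡ P ℤ.* a ℤ.* (B ℤ.* x ℤ.- y)
    factor = ℤ-solve-∀
    regroup : ∀ P a m → P ℤ.* a ℤ.* (m ℤ.* P) ≡ a ℤ.* m ℤ.* (P ℤ.* P)
    regroup = ℤ-solve-∀

  p²∣⟨⟩binomial-term : ∀ a {j} → j ℕ.< p′ →
    (ι (+ p) * ι (+ p)) ∣⟨ p ⟩ (ι (+ (p C suc j)) * ι (a ℤ.^ suc j) + ι (+ p) * (ι ((ℤ.- a) ℤ.^ suc j) ⊘ ι (+ suc j)))
  p²∣⟨⟩binomial-term a {j} j<p′ with p²∣k*pCk*a^k+p*[-a]^k a j<p′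
  ... | ℤS.divides n numerator≡n*p² = fraction n (+ suc j) p∤1+j (begin
    (B * A + P * (N ⊘ D)) * D            ≡⟨ distribute B A P (N ⊘ D) D ⟩
    B * D * A + P * ((N ⊘ D) * D)        ≡⟨ cong (λ t → B * D * A + P * t) (x⊘y*y≡x N (ι≢0 (+ suc j) p∤1+j)) ⟩
    B * D * A + P * N                    ≡⟨ ι-numerator ⟨
    ι numerator                          ≡⟨ cong ι numerator≡n*p² ⟩
    ι (n ℤ.* (+ p ℤ.* + p))              ≡⟨ trans (ι-* n (+ p ℤ.* + p)) (cong (ι n *_) (ι-* (+ p) (+ p))) ⟩
    ι n * (P * P)                        ≡⟨ ℚP.*-comm (ι n) (P * P) ⟩
    P * P * ι n                          ∎)
    where
    open ≡-Reasoning
    P D B A N : ℚ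
    P = ι (+ p)
    D = ι (+ suc j)
    B = ι (+ (p C suc j))
    A = ι (a ℤ.^ suc j)
    N = ι ((ℤ.- a) ℤ.^ suc j)
    numerator : ℤ
    numerator = + (p C suc j) ℤ.* + suc j ℤ.* a ℤ.^ suc j ℤ.+ + p ℤ.* (ℤ.- a) ℤ.^ suc j
    p∤1+j : ¬ (+ p ∣ + suc j)
    p∤1+j = p∤[1+k] (ℕ.s≤s j<p′)
    distribute : ∀ B A P x D → (B * A + P * x) * D ≡ B * D * A + P * (x * D)
    distribute = solve-∀ ℚ-ring
    ι-numerator : ι numerator ≡ B * D * A + P * N
    ι-numerator = trans (ι-+ (+ (p C suc j) ℤ.* + suc j ℤ.* a ℤ.^ suc j) (+ p ℤ.* (ℤ.- a) ℤ.^ suc j))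
      (cong₂ _+_ (trans (ι-* (+ (p C suc j) ℤ.* + suc j) (a ℤ.^ suc j)) (cong (_* A) (ι-* (+ (p C suc j)) (+ suc j))))
                 (ι-* (+ p) ((ℤ.- a) ℤ.^ suc j)))

-- Binomial sums over a residue class mod 3

binomialTerm : ℤ → ℕ → ℕ → ℕ → ℚ
binomialTerm a r n k = δ₃ r k * (ι (+ (n C k)) * ι (a ℤ.^ k))

S : ℤ → ℕ → ℕ → ℚ
S a r n = ∑[ k < suc n ] binomialTerm a r n (toℕ k)

binomialTerm-pascal : ∀ a r n j →
  binomialTerm a r (suc n) (suc j) ≡ binomialTerm a r n (suc j) + ι a * binomialTerm a (suc (suc r)) n j
binomialTerm-pascal a r n j = begin
  δ₃ r (suc j) * (ι (+ (suc n C suc j)) * ι (a ℤ.^ suc j))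
    ≡⟨ cong₂ (λ c A → δ₃ r (suc j) * (c * A))
             (trans (cong (λ c → ι (+ c)) (pascal n j)) (ι-+ (+ (n C j)) (+ (n C suc j)))) (ι-* a (a ℤ.^ j)) ⟩
  δ₃ r (suc j) * ((ι (+ (n C j)) + ι (+ (n C suc j))) * (ι a * ι (a ℤ.^ j)))
    ≡⟨ distribute (δ₃ r (suc j)) (ι (+ (n C j))) (ι (+ (n C suc j))) (ι a) (ι (a ℤ.^ j)) ⟩
  δ₃ r (suc j) * (ι (+ (n C suc j)) * (ι a * ι (a ℤ.^ j))) + ι a * (δ₃ r (suc j) * (ι (+ (n C j)) * ι (a ℤ.^ j)))
    ≡⟨ cong₂ (λ A d → δ₃ r (suc j) * (ι (+ (n C suc j)) * A) + ι a * (d * (ι (+ (n C j)) * ι (a ℤ.^ j))))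
             (ι-* a (a ℤ.^ j)) (sym (δ₃-suc r j)) ⟨
  binomialTerm a r n (suc j) + ι a * binomialTerm a (suc (suc r)) n j ∎
  where
  open ≡-Reasoning
  distribute : ∀ δ c c′ A Aʲ → δ * ((c + c′) * (A * Aʲ)) ≡ δ * (c′ * (A * Aʲ)) + A * (δ * (c * Aʲ))
  distribute = solve-∀ ℚ-ring

binomialTerm-above : ∀ a r n → binomialTerm a r n (suc n) ≡ 0ℚ
binomialTerm-above a r n = begin
  δ₃ r (suc n) * (ι (+ (n C suc n)) * ι (a ℤ.^ suc n))
    ≡⟨ cong (λ c → δ₃ r (suc n) * (ι (+ c) * ι (a ℤ.^ suc n))) (k>n⇒nCk≡0 (ℕP.n<1+n n)) ⟩
  δ₃ r (suc n) * (0ℚ * ι (a ℤ.^ suc n))   ≡⟨ cong (δ₃ r (suc n) *_) (ℚP.*-zeroˡ (ι (a ℤ.^ suc n))) ⟩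
  δ₃ r (suc n) * 0ℚ                       ≡⟨ ℚP.*-zeroʳ (δ₃ r (suc n)) ⟩
  0ℚ                                      ∎
  where open ≡-Reasoning

S-suc : ∀ a r n → S a r (suc n) ≡ S a r n + ι a * S a (suc (suc r)) n
S-suc a r n = begin
  t 0 + ∑[ j < suc n ] binomialTerm a r (suc n) (suc (toℕ j))
    ≡⟨ cong (λ s → t 0 + s) (sum-cong-≗ {suc n} {λ j → binomialTerm a r (suc n) (suc (toℕ j))}
                                          (λ j → binomialTerm-pascal a r n (toℕ j))) ⟩
  t 0 + ∑[ j < suc n ] (t (suc (toℕ j)) + ι a * t″ (toℕ j))
    ≡⟨ cong (λ s → t 0 + s) (∑-distrib-+ {suc n} (λ j → t (suc (toℕ j))) (λ j → ι a * t″ (toℕ j))) ⟩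
  t 0 + (∑[ j < suc n ] t (suc (toℕ j)) + ∑[ j < suc n ] (ι a * t″ (toℕ j)))
    ≡⟨ cong (λ s → t 0 + (∑[ j < suc n ] t (suc (toℕ j)) + s)) (*-distribˡ-sum {suc n} (ι a) (λ j → t″ (toℕ j))) ⟨
  t 0 + (∑[ j < suc n ] t (suc (toℕ j)) + ι a * S a (suc (suc r)) n)
    ≡⟨ ℚP.+-assoc (t 0) (∑[ j < suc n ] t (suc (toℕ j))) (ι a * S a (suc (suc r)) n) ⟨
  ∑[ k < suc (suc n) ] t (toℕ k) + ι a * S a (suc (suc r)) n
    ≡⟨ cong (λ s → s + ι a * S a (suc (suc r)) n) (∑-last (suc n) t) ⟩
  S a r n + t (suc n) + ι a * S a (suc (suc r)) n
    ≡⟨ cong (λ s → S a r n + s + ι a * S a (suc (suc r)) n) (binomialTerm-above a r n) ⟩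
  S a r n + 0ℚ + ι a * S a (suc (suc r)) n
    ≡⟨ cong (λ s → s + ι a * S a (suc (suc r)) n) (ℚP.+-identityʳ (S a r n)) ⟩
  S a r n + ι a * S a (suc (suc r)) n ∎
  where
  open ≡-Reasoning
  t t″ : ℕ → ℚ
  t = binomialTerm a r n
  t″ = binomialTerm a (suc (suc r)) n

S-cong : ∀ a r r′ n → r % 3 ≡ r′ % 3 → S a r n ≡ S a r′ n
S-cong a r r′ n r≡r′ = sum-cong-≗ {suc n} {λ k → binomialTerm a r n (toℕ k)}
  (λ k → cong (_* (ι (+ (n C toℕ k)) * ι (a ℤ.^ toℕ k))) (δ₃-cong {r} {r′} (toℕ k) r≡r′))

module _ (a : ℤ) where

  private
    A Q : ℚ
    A = ι a
    Q = A * A - A + 1ℚ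
    S₀ S₁ S₂ : ℕ → ℚ
    S₀ = S a 0
    S₁ = S a 1
    S₂ = S a 2

  S₀-suc : ∀ n → S₀ (suc n) ≡ S₀ n + A * S₂ n
  S₀-suc = S-suc a 0

  S₁-suc : ∀ n → S₁ (suc n) ≡ S₁ n + A * S₀ n
  S₁-suc n = trans (S-suc a 1 n) (cong (λ s → S₁ n + A * s) (S-cong a 3 0 n refl))

  S₂-suc : ∀ n → S₂ (suc n) ≡ S₂ n + A * S₁ n
  S₂-suc n = trans (S-suc a 2 n) (cong (λ s → S₂ n + A * s) (S-cong a 4 1 n refl))

  S-suc³ : ∀ n (f : ℚ → ℚ → ℚ → ℚ) →
    f (S₀ (suc n)) (S₁ (suc n)) (S₂ (suc n)) ≡ f (S₀ n + A * S₂ n) (S₁ n + A * S₀ n) (S₂ n + A * S₁ n)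
  S-suc³ n f = trans (cong (λ s₀ → f s₀ (S₁ (suc n)) (S₂ (suc n))) (S₀-suc n))
                     (cong₂ (f (S₀ n + A * S₂ n)) (S₁-suc n) (S₂-suc n))

  S₀+S₁+S₂≡[1+a]^n : ∀ n → S₀ n + S₁ n + S₂ n ≡ ι ((+ 1 ℤ.+ a) ℤ.^ n)
  S₀+S₁+S₂≡[1+a]^n zero    = refl
  S₀+S₁+S₂≡[1+a]^n (suc n) = begin
    S₀ (suc n) + S₁ (suc n) + S₂ (suc n)
      ≡⟨ S-suc³ n (λ s₀ s₁ s₂ → s₀ + s₁ + s₂) ⟩
    (S₀ n + A * S₂ n) + (S₁ n + A * S₀ n) + (S₂ n + A * S₁ n)
      ≡⟨ factor A (S₀ n) (S₁ n) (S₂ n) ⟩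
    (1ℚ + A) * (S₀ n + S₁ n + S₂ n)
      ≡⟨ cong₂ _*_ (sym (ι-+ (+ 1) a)) (S₀+S₁+S₂≡[1+a]^n n) ⟩
    ι (+ 1 ℤ.+ a) * ι ((+ 1 ℤ.+ a) ℤ.^ n)
      ≡⟨ ι-* (+ 1 ℤ.+ a) ((+ 1 ℤ.+ a) ℤ.^ n) ⟨
    ι ((+ 1 ℤ.+ a) ℤ.^ suc n) ∎
    where
    open ≡-Reasoning
    factor : ∀ A x y z → (x + A * z) + (y + A * x) + (z + A * y) ≡ (1ℚ + A) * (x + y + z)
    factor = solve-∀ ℚ-ring

  ι-a²-a+1 : ι (a ℤ.* a ℤ.- a ℤ.+ + 1) ≡ Q
  ι-a²-a+1 = trans (ι-+ (a ℤ.* a ℤ.- a) (+ 1)) (cong (_+ 1ℚ) (trans (ι-- (a ℤ.* a) a) (cong (_- A) (ι-* a a))))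

  ι-u-suc-suc : ∀ n → ι (u a (suc (suc n))) ≡ (1ℚ + 1ℚ - A) * ι (u a (suc n)) - Q * ι (u a n)
  ι-u-suc-suc n = trans (ι-- ((+ 2 ℤ.- a) ℤ.* u a (suc n)) ((a ℤ.* a ℤ.- a ℤ.+ + 1) ℤ.* u a n))
    (cong₂ _-_ (trans (ι-* (+ 2 ℤ.- a) (u a (suc n))) (cong (_* ι (u a (suc n))) (ι-- (+ 2) a)))
               (trans (ι-* (a ℤ.* a ℤ.- a ℤ.+ + 1) (u a n)) (cong (_* ι (u a n)) ι-a²-a+1)))

  a*u≡S : ∀ n → (A * ι (u a n) ≡ S₁ n - S₂ n)
              × (A * ι (u a (suc n)) ≡ (1ℚ - A) * S₁ n - S₂ n + A * S₀ n)
  a*u≡S zero = ℚP.*-zeroʳ A , base A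
    where
    base : ∀ A → A * 1ℚ ≡ (1ℚ - A) * 0ℚ - 0ℚ + A * 1ℚ
    base = solve-∀ ℚ-ring
  a*u≡S (suc n) = a*uₙ₊₁≡ , a*uₙ₊₂≡
    where
    open ≡-Reasoning
    a*uₙ₊₁≡ : A * ι (u a (suc n)) ≡ S₁ (suc n) - S₂ (suc n)
    a*uₙ₊₁≡ = begin
      A * ι (u a (suc n))                       ≡⟨ proj₂ (a*u≡S n) ⟩
      (1ℚ - A) * S₁ n - S₂ n + A * S₀ n         ≡⟨ regroup A (S₀ n) (S₁ n) (S₂ n) ⟩
      (S₁ n + A * S₀ n) - (S₂ n + A * S₁ n)     ≡⟨ S-suc³ n (λ _ s₁ s₂ → s₁ - s₂) ⟨
      S₁ (suc n) - S₂ (suc n)                   ∎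
      where
      regroup : ∀ A x y z → (1ℚ - A) * y - z + A * x ≡ (y + A * x) - (z + A * y)
      regroup = solve-∀ ℚ-ring
    a*uₙ₊₂≡ : A * ι (u a (suc (suc n))) ≡ (1ℚ - A) * S₁ (suc n) - S₂ (suc n) + A * S₀ (suc n)
    a*uₙ₊₂≡ = begin
      A * ι (u a (suc (suc n)))
        ≡⟨ cong (A *_) (ι-u-suc-suc n) ⟩
      A * ((1ℚ + 1ℚ - A) * ι (u a (suc n)) - Q * ι (u a n))
        ≡⟨ distribute A (ι (u a n)) (ι (u a (suc n))) ⟩
      (1ℚ + 1ℚ - A) * (A * ι (u a (suc n))) - Q * (A * ι (u a n))
        ≡⟨ cong₂ (λ s t → (1ℚ + 1ℚ - A) * s - Q * t) (proj₂ (a*u≡S n)) (proj₁ (a*u≡S n)) ⟩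
      (1ℚ + 1ℚ - A) * ((1ℚ - A) * S₁ n - S₂ n + A * S₀ n) - Q * (S₁ n - S₂ n)
        ≡⟨ regroup A (S₀ n) (S₁ n) (S₂ n) ⟩
      (1ℚ - A) * (S₁ n + A * S₀ n) - (S₂ n + A * S₁ n) + A * (S₀ n + A * S₂ n)
        ≡⟨ S-suc³ n (λ s₀ s₁ s₂ → (1ℚ - A) * s₁ - s₂ + A * s₀) ⟨
      (1ℚ - A) * S₁ (suc n) - S₂ (suc n) + A * S₀ (suc n) ∎
      where
      distribute : ∀ A x y → A * ((1ℚ + 1ℚ - A) * y - (A * A - A + 1ℚ) * x)
                           ≡ (1ℚ + 1ℚ - A) * (A * y) - (A * A - A + 1ℚ) * (A * x)
      distribute = solve-∀ ℚ-ring
      regroup : ∀ A x y z → (1ℚ + 1ℚ - A) * ((1ℚ - A) * y - z + A * x) - (A * A - A + 1ℚ) * (y - z)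
                          ≡ (1ℚ - A) * (y + A * x) - (z + A * y) + A * (x + A * z)
      regroup = solve-∀ ℚ-ring

  [a²-a+1]*a*u≡S : ∀ n → Q * (A * ι (u a n)) ≡ S₁ (suc n) - (1ℚ - A) * S₂ (suc n) - A * S₀ (suc n)
  [a²-a+1]*a*u≡S n = begin
    Q * (A * ι (u a n))        ≡⟨ cong (Q *_) (proj₁ (a*u≡S n)) ⟩
    Q * (S₁ n - S₂ n)          ≡⟨ regroup A (S₀ n) (S₁ n) (S₂ n) ⟩
    (S₁ n + A * S₀ n) - (1ℚ - A) * (S₂ n + A * S₁ n) - A * (S₀ n + A * S₂ n)
                               ≡⟨ S-suc³ n (λ s₀ s₁ s₂ → s₁ - (1ℚ - A) * s₂ - A * s₀) ⟨
    S₁ (suc n) - (1ℚ - A) * S₂ (suc n) - A * S₀ (suc n) ∎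
    where
    open ≡-Reasoning
    regroup : ∀ A x y z → (A * A - A + 1ℚ) * (y - z) ≡ (y + A * x) - (1ℚ - A) * (z + A * y) - A * (x + A * z)
    regroup = solve-∀ ℚ-ring

-- The congruence Sᵣ(p) + p·K_{p,3,r}(a) ≡ [r ≡ 0] + [p ≡ r]·aᵖ (mod p²)

module _ (a : ℤ) {p′ : ℕ} (p-prime : Prime (suc p′)) where

  private
    p : ℕ
    p = suc p′
    P : ℚ
    P = ι (+ p)
    t : ℕ → ℕ → ℚ
    t r = binomialTerm a r p
    summand : ℕ → Fin p′ → ℚ
    summand r j = t r (suc (toℕ j)) + P * Kterm a r (suc (toℕ j))

  S+pK-δ≡∑summand : ∀ r → S a r p + P * K p r a - (δ₃ r 0 + δ₃ r p * ι (a ℤ.^ p)) ≡ ∑[ j < p′ ] summand r j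
  S+pK-δ≡∑summand r = begin
    t r 0 + ∑[ j < p ] t r (suc (toℕ j)) + P * K p r a - (δ₃ r 0 + δ₃ r p * ι (a ℤ.^ p))
      ≡⟨ cong₂ (λ s k → t r 0 + s + P * k - (δ₃ r 0 + δ₃ r p * ι (a ℤ.^ p)))
               (∑-last p′ (λ j → t r (suc j))) (sumℚ-map-applyUpTo p′ (λ i → Kterm a r (suc i)) (λ i → i)) ⟩
    t r 0 + (Σt + t r p) + P * ΣK - (δ₃ r 0 + δ₃ r p * ι (a ℤ.^ p))
      ≡⟨ cong₂ (λ s₀ sₚ → s₀ + (Σt + sₚ) + P * ΣK - (δ₃ r 0 + δ₃ r p * ι (a ℤ.^ p))) first-term last-term ⟩
    δ₃ r 0 + (Σt + δ₃ r p * ι (a ℤ.^ p)) + P * ΣK - (δ₃ r 0 + δ₃ r p * ι (a ℤ.^ p))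
      ≡⟨ cancel (δ₃ r 0) Σt (δ₃ r p * ι (a ℤ.^ p)) P ΣK ⟩
    Σt + P * ΣK
      ≡⟨ cong (λ s → Σt + s) (*-distribˡ-sum {p′} P (λ j → Kterm a r (suc (toℕ j)))) ⟩
    Σt + ∑[ j < p′ ] (P * Kterm a r (suc (toℕ j)))
      ≡⟨ ∑-distrib-+ {p′} (λ j → t r (suc (toℕ j))) (λ j → P * Kterm a r (suc (toℕ j))) ⟨
    ∑[ j < p′ ] summand r j ∎
    where
    open ≡-Reasoning
    Σt ΣK : ℚ
    Σt = ∑[ j < p′ ] t r (suc (toℕ j))
    ΣK = ∑[ j < p′ ] Kterm a r (suc (toℕ j))
    first-term : t r 0 ≡ δ₃ r 0
    first-term = ℚP.*-identityʳ (δ₃ r 0)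
    last-term : t r p ≡ δ₃ r p * ι (a ℤ.^ p)
    last-term = trans (cong (λ c → δ₃ r p * (ι (+ c) * ι (a ℤ.^ p))) (nCn≡1 p))
                      (cong (δ₃ r p *_) (ℚP.*-identityˡ (ι (a ℤ.^ p))))
    cancel : ∀ d₀ s dₚ P k → d₀ + (s + dₚ) + P * k - (d₀ + dₚ) ≡ s + P * k
    cancel = solve-∀ ℚ-ring

  p²∣⟨⟩summand : ∀ r j → (P * P) ∣⟨ p ⟩ summand r j
  p²∣⟨⟩summand r j = subst ((P * P) ∣⟨ p ⟩_) (sym (begin
    summand r j                ≡⟨ cong (λ k → t r (suc (toℕ j)) + P * k) (Kterm≡δ₃* a r (suc (toℕ j))) ⟩
    δ * x + P * (δ * y)        ≡⟨ factor δ x P y ⟩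
    δ * (x + P * y)            ∎))
    (∣⟨⟩-*ˡ p-prime (1∣⟨⟩δ₃ p-prime r (suc (toℕ j))) (p²∣⟨⟩binomial-term p-prime a (FinP.toℕ<n j)))
    where
    open ≡-Reasoning
    δ x y : ℚ
    δ = δ₃ r (suc (toℕ j))
    x = ι (+ (p C suc (toℕ j))) * ι (a ℤ.^ suc (toℕ j))
    y = ι ((ℤ.- a) ℤ.^ suc (toℕ j)) ⊘ ι (+ suc (toℕ j))
    factor : ∀ δ x P y → δ * x + P * (δ * y) ≡ δ * (x + P * y)
    factor = solve-∀ ℚ-ring

  p²∣⟨⟩S+pK-δ : ∀ r → (P * P) ∣⟨ p ⟩ (S a r p + P * K p r a - (δ₃ r 0 + δ₃ r p * ι (a ℤ.^ p)))
  p²∣⟨⟩S+pK-δ r = subst ((P * P) ∣⟨ p ⟩_) (sym (S+pK-δ≡∑summand r)) (∣⟨⟩-sum p-prime (summand r) (p²∣⟨⟩summand r))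

-- Each hypothesis `x ≡ e` with x a variable is matched by refl, so that what remains is a
-- single ring identity.
clear-denominators₁ : ∀ U T N₂ X₁ N₃ Y₁ {P A Q D} → P ≢ 0ℚ → Q ≢ 0ℚ → D ≢ 0ℚ → D ≡ A * Q →
  (U ⊘ P - (T ⊘ D - (N₂ ⊘ Q) * (X₁ ⊘ P) + (N₃ ⊘ D) * (Y₁ ⊘ P))) * P * D
    ≡ U * (A * Q) - T * P + N₂ * X₁ * A - N₃ * Y₁
clear-denominators₁ U T N₂ X₁ N₃ Y₁ {P} {A} {Q} P≢0 Q≢0 D≢0 refl =
  expand (U ⊘ P) (T ⊘ (A * Q)) (N₂ ⊘ Q) (X₁ ⊘ P) (N₃ ⊘ (A * Q)) (Y₁ ⊘ P) P A Q
         (x⊘y*y≡x U P≢0) (x⊘y*y≡x T D≢0) (x⊘y*y≡x N₂ Q≢0) (x⊘y*y≡x X₁ P≢0) (x⊘y*y≡x N₃ D≢0) (x⊘y*y≡x Y₁ P≢0)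
  where
  expand : ∀ u r₁ r₂ q₁ r₃ q₂ P A Q {U T N₂ X₁ N₃ Y₁} →
    u * P ≡ U → r₁ * (A * Q) ≡ T → r₂ * Q ≡ N₂ → q₁ * P ≡ X₁ → r₃ * (A * Q) ≡ N₃ → q₂ * P ≡ Y₁ →
    (u - (r₁ - r₂ * q₁ + r₃ * q₂)) * P * (A * Q) ≡ U * (A * Q) - T * P + N₂ * X₁ * A - N₃ * Y₁
  expand u r₁ r₂ q₁ r₃ q₂ P A Q refl refl refl refl refl refl = solve (u ∷ r₁ ∷ r₂ ∷ q₁ ∷ r₃ ∷ q₂ ∷ P ∷ A ∷ Q ∷ []) ℚ-ring

clear-denominators₂ : ∀ U T N Y₁ {P A} → P ≢ 0ℚ → A ≢ 0ℚ →
  (U ⊘ P - (T ⊘ A - (N ⊘ A) * (Y₁ ⊘ P))) * P * A ≡ U * A - T * P + N * Y₁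
clear-denominators₂ U T N Y₁ {P} {A} P≢0 A≢0 =
  expand (U ⊘ P) (T ⊘ A) (N ⊘ A) (Y₁ ⊘ P) P A (x⊘y*y≡x U P≢0) (x⊘y*y≡x T A≢0) (x⊘y*y≡x N A≢0) (x⊘y*y≡x Y₁ P≢0)
  where
  expand : ∀ u r₁ r₂ q P A {U T N Y₁} → u * P ≡ U → r₁ * A ≡ T → r₂ * A ≡ N → q * P ≡ Y₁ →
    (u - (r₁ - r₂ * q)) * P * A ≡ U * A - T * P + N * Y₁
  expand u r₁ r₂ q P A refl refl refl refl = solve (u ∷ r₁ ∷ r₂ ∷ q ∷ P ∷ A ∷ []) ℚ-ring

numerator₁ : ∀ {A P X Y K₀ K₁ S₀ S₁ U S₂ Q T N₂ X₁ N₃ Y₁} →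
  Q ≡ A * A - A + 1ℚ → S₂ ≡ (1ℚ + A) * Y - S₀ - S₁ → T ≡ ((1ℚ + 1ℚ) * A - 1ℚ) * K₀ + (A - (1ℚ + 1ℚ)) * K₁ →
  N₂ ≡ A - (1ℚ + 1ℚ) → X₁ ≡ X - 1ℚ → N₃ ≡ A * A - 1ℚ → Y₁ ≡ Y - 1ℚ →
  Q * (A * U) ≡ S₁ - (1ℚ - A) * S₂ - A * S₀ →
  U * (A * Q) - T * P + N₂ * X₁ * A - N₃ * Y₁
    ≡ (1ℚ + 1ℚ - A) * (S₁ + P * K₁ - A * X) + (1ℚ - (1ℚ + 1ℚ) * A) * (S₀ + P * K₀ - 1ℚ)
numerator₁ {A} {P} {X} {Y} {K₀} {K₁} {S₀} {S₁} {U} refl refl refl refl refl refl refl Q*A*U≡ =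
  cancel-vanishing Q*A*U≡ (solve (A ∷ P ∷ X ∷ Y ∷ K₀ ∷ K₁ ∷ S₀ ∷ S₁ ∷ U ∷ []) ℚ-ring)

numerator₂ : ∀ {A P Y K₀ K₁ S₀ S₁ U S₂ T N Y₁} →
  S₂ ≡ (1ℚ + A) * Y - S₀ - S₁ → T ≡ (A - (1ℚ + 1ℚ)) * K₁ - (A + 1ℚ) * K₀ → N ≡ A + 1ℚ → Y₁ ≡ Y - 1ℚ →
  A * U ≡ (1ℚ - A) * S₁ - S₂ + A * S₀ →
  U * A - T * P + N * Y₁ ≡ (1ℚ + 1ℚ - A) * (S₁ + P * K₁) + (1ℚ + A) * (S₀ + P * K₀ - 1ℚ)
numerator₂ {A} {P} {Y} {K₀} {K₁} {S₀} {S₁} {U} refl refl refl refl A*U≡ =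
  cancel-vanishing A*U≡ (solve (A ∷ P ∷ Y ∷ K₀ ∷ K₁ ∷ S₀ ∷ S₁ ∷ U ∷ []) ℚ-ring)

module _ (a : ℤ) {p′ : ℕ} (p-prime : Prime (suc p′)) (p∤a : ¬ (+ suc p′ ∣ a)) where

  private
    p : ℕ
    p = suc p′
    P A X Y S₀ S₁ S₂ K₀ K₁ R₁ R₂ : ℚ
    P = ι (+ p)
    A = ι a
    X = ι (a ℤ.^ p′)
    Y = ι ((+ 1 ℤ.+ a) ℤ.^ p′)
    S₀ = S a 0 p
    S₁ = S a 1 p
    S₂ = S a 2 p
    K₀ = K p 0 a
    K₁ = K p 1 a
    R₁ = ((ι (+ 2 ℤ.* a ℤ.- + 1) * K₀ + ι (a ℤ.- + 2) * K₁) ⊘ ι (a ℤ.* (a ℤ.* a ℤ.- a ℤ.+ + 1)))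
         - (ι (a ℤ.- + 2) ⊘ ι (a ℤ.* a ℤ.- a ℤ.+ + 1)) * q p a
         + (ι (a ℤ.* a ℤ.- + 1) ⊘ ι (a ℤ.* (a ℤ.* a ℤ.- a ℤ.+ + 1))) * q p (a ℤ.+ + 1)
    R₂ = ((ι (a ℤ.- + 2) * K₁ - ι (a ℤ.+ + 1) * K₀) ⊘ A) - (ι (a ℤ.+ + 1) ⊘ A) * q p (a ℤ.+ + 1)

    P≢0 : P ≢ 0ℚ
    P≢0 P≡0 = ¬prime[0] (subst Prime (ℤP.+-injective (ι-injective {+ p} {+ 0} P≡0)) p-prime)

    S₂≡ : S₂ ≡ (1ℚ + A) * Y - S₀ - S₁
    S₂≡ = begin
      S₂                                ≡⟨ isolate S₀ S₁ S₂ ⟩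
      S₀ + S₁ + S₂ - S₀ - S₁            ≡⟨ cong (λ w → w - S₀ - S₁) (S₀+S₁+S₂≡[1+a]^n a p) ⟩
      ι ((+ 1 ℤ.+ a) ℤ.^ p) - S₀ - S₁   ≡⟨ cong (λ w → w - S₀ - S₁) (ι-* (+ 1 ℤ.+ a) ((+ 1 ℤ.+ a) ℤ.^ p′)) ⟩
      ι (+ 1 ℤ.+ a) * Y - S₀ - S₁       ≡⟨ cong (λ w → w * Y - S₀ - S₁) (ι-+ (+ 1) a) ⟩
      (1ℚ + A) * Y - S₀ - S₁            ∎
      where
      open ≡-Reasoning
      isolate : ∀ x y z → z ≡ x + y + z - x - y
      isolate = solve-∀ ℚ-ring

    ι[[a+1]^[p-1]-1]≡ : ι ((a ℤ.+ + 1) ℤ.^ p′ ℤ.- + 1) ≡ Y - 1ℚ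
    ι[[a+1]^[p-1]-1]≡ = trans (ι-- ((a ℤ.+ + 1) ℤ.^ p′) (+ 1)) (cong (λ b → ι (b ℤ.^ p′) - 1ℚ) (ℤP.+-comm a (+ 1)))

    1∣⟨⟩ : ∀ {x} n → ι n ≡ x → 1ℚ ∣⟨ p ⟩ x
    1∣⟨⟩ n ιn≡x = subst (1ℚ ∣⟨ p ⟩_) ιn≡x (1∣⟨⟩ι p-prime n)

    p²∣⟨⟩S+pK-c : ∀ r {c} → δ₃ r 0 + δ₃ r p * ι (a ℤ.^ p) ≡ c → (P * P) ∣⟨ p ⟩ (S a r p + P * K p r a - c)
    p²∣⟨⟩S+pK-c r {c} δ≡c = subst (λ c → (P * P) ∣⟨ p ⟩ (S a r p + P * K p r a - c)) δ≡c (p²∣⟨⟩S+pK-δ a p-prime r)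

    p²∣⟨⟩S₀+pK₀-1 : p % 3 ≢ 0 → (P * P) ∣⟨ p ⟩ (S₀ + P * K₀ - 1ℚ)
    p²∣⟨⟩S₀+pK₀-1 p≢0 = p²∣⟨⟩S+pK-c 0 (begin
      1ℚ + δ₃ 0 p * ι (a ℤ.^ p)    ≡⟨ cong (λ d → 1ℚ + d * ι (a ℤ.^ p)) (δ₃-≢ 0 p p≢0) ⟩
      1ℚ + 0ℚ * ι (a ℤ.^ p)        ≡⟨ cong (λ z → 1ℚ + z) (ℚP.*-zeroˡ (ι (a ℤ.^ p))) ⟩
      1ℚ                           ∎)
      where open ≡-Reasoning

    p²∣⟨⟩S₁+pK₁-a^p : p % 3 ≡ 1 → (P * P) ∣⟨ p ⟩ (S₁ + P * K₁ - A * X)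
    p²∣⟨⟩S₁+pK₁-a^p p≡1 = p²∣⟨⟩S+pK-c 1 (begin
      0ℚ + δ₃ 1 p * ι (a ℤ.^ p)    ≡⟨ ℚP.+-identityˡ (δ₃ 1 p * ι (a ℤ.^ p)) ⟩
      δ₃ 1 p * ι (a ℤ.^ p)         ≡⟨ cong (_* ι (a ℤ.^ p)) (δ₃-≡ 1 p p≡1) ⟩
      1ℚ * ι (a ℤ.^ p)             ≡⟨ ℚP.*-identityˡ (ι (a ℤ.^ p)) ⟩
      ι (a ℤ.^ p)                  ≡⟨ ι-* a (a ℤ.^ p′) ⟩
      A * X                        ∎)
      where open ≡-Reasoning

    p²∣⟨⟩S₁+pK₁ : p % 3 ≡ 2 → (P * P) ∣⟨ p ⟩ (S₁ + P * K₁)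
    p²∣⟨⟩S₁+pK₁ p≡2 = subst ((P * P) ∣⟨ p ⟩_) (ℚP.+-identityʳ (S₁ + P * K₁)) (p²∣⟨⟩S+pK-c 1 (begin
      0ℚ + δ₃ 1 p * ι (a ℤ.^ p)    ≡⟨ cong (λ d → 0ℚ + d * ι (a ℤ.^ p)) (δ₃-≢ 1 p (λ p≡1 → 2≢1 (trans (sym p≡2) p≡1))) ⟩
      0ℚ + 0ℚ * ι (a ℤ.^ p)        ≡⟨ cong (λ z → 0ℚ + z) (ℚP.*-zeroˡ (ι (a ℤ.^ p))) ⟩
      0ℚ                           ∎))
      where
      open ≡-Reasoning
      2≢1 : 2 ≢ 1
      2≢1 ()

  u[p-1]/p≡ : p % 3 ≡ 1 → ¬ (+ p ∣ a ℤ.* a ℤ.- a ℤ.+ + 1) → (ι (u a p′) ⊘ P) ≡ R₁ [modℚ p ]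
  u[p-1]/p≡ p≡1 p∤Qᶻ = ∣⟨⟩⇒≡[modℚ] p-prime {ι (u a p′) ⊘ P} {R₁}
    (∣⟨⟩-cancelʳ P≢0 (∣⟨⟩-cancel-unitʳ p-prime (a ℤ.* Qᶻ) p∤aQᶻ (subst ((P * P) ∣⟨ p ⟩_) (sym identity) combination)))
    where
    Qᶻ : ℤ
    Qᶻ = a ℤ.* a ℤ.- a ℤ.+ + 1
    p∤aQᶻ : ¬ (+ p ∣ a ℤ.* Qᶻ)
    p∤aQᶻ = p∤m*n p-prime a Qᶻ p∤a p∤Qᶻ
    T : ℚ
    T = ι (+ 2 ℤ.* a ℤ.- + 1) * K₀ + ι (a ℤ.- + 2) * K₁
    identity : (ι (u a p′) ⊘ P - R₁) * P * ι (a ℤ.* Qᶻ)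
             ≡ (1ℚ + 1ℚ - A) * (S₁ + P * K₁ - A * X) + (1ℚ - (1ℚ + 1ℚ) * A) * (S₀ + P * K₀ - 1ℚ)
    identity = trans
      (clear-denominators₁ (ι (u a p′)) T (ι (a ℤ.- + 2)) (ι (a ℤ.^ p′ ℤ.- + 1)) (ι (a ℤ.* a ℤ.- + 1))
        (ι ((a ℤ.+ + 1) ℤ.^ p′ ℤ.- + 1)) {A = A} P≢0 (ι≢0 Qᶻ p∤Qᶻ) (ι≢0 (a ℤ.* Qᶻ) p∤aQᶻ) (ι-* a Qᶻ))
      (numerator₁ {A} {P} {X} {Y} {K₀} {K₁} {S₀} {S₁} {ι (u a p′)} (ι-a²-a+1 a) S₂≡
        (cong₂ (λ c₀ c₁ → c₀ * K₀ + c₁ * K₁) (trans (ι-- (+ 2 ℤ.* a) (+ 1)) (cong (_- 1ℚ) (ι-* (+ 2) a))) (ι-- a (+ 2)))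
        (ι-- a (+ 2)) (ι-- (a ℤ.^ p′) (+ 1)) (trans (ι-- (a ℤ.* a) (+ 1)) (cong (_- 1ℚ) (ι-* a a))) ι[[a+1]^[p-1]-1]≡
        (trans (cong (_* (A * ι (u a p′))) (ι-a²-a+1 a)) ([a²-a+1]*a*u≡S a p′)))
    combination : (P * P) ∣⟨ p ⟩ ((1ℚ + 1ℚ - A) * (S₁ + P * K₁ - A * X) + (1ℚ - (1ℚ + 1ℚ) * A) * (S₀ + P * K₀ - 1ℚ))
    combination = ∣⟨⟩-+ p-prime
      (∣⟨⟩-*ˡ p-prime (1∣⟨⟩ (+ 2 ℤ.- a) (ι-- (+ 2) a)) (p²∣⟨⟩S₁+pK₁-a^p p≡1))
      (∣⟨⟩-*ˡ p-prime (1∣⟨⟩ (+ 1 ℤ.- + 2 ℤ.* a) (trans (ι-- (+ 1) (+ 2 ℤ.* a)) (cong (1ℚ -_) (ι-* (+ 2) a))))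
                      (p²∣⟨⟩S₀+pK₀-1 (λ p≡0 → 1≢0 (trans (sym p≡1) p≡0))))
      where
      1≢0 : 1 ≢ 0
      1≢0 ()

  u[p+1]/p≡ : p % 3 ≡ 2 → (ι (u a (p ℕ.+ 1)) ⊘ P) ≡ R₂ [modℚ p ]
  u[p+1]/p≡ p≡2 = ∣⟨⟩⇒≡[modℚ] p-prime {ι (u a (p ℕ.+ 1)) ⊘ P} {R₂}
    (∣⟨⟩-cancelʳ P≢0 (∣⟨⟩-cancel-unitʳ p-prime a p∤a (subst ((P * P) ∣⟨ p ⟩_) (sym identity) combination)))
    where
    T : ℚ
    T = ι (a ℤ.- + 2) * K₁ - ι (a ℤ.+ + 1) * K₀
    identity : (ι (u a (p ℕ.+ 1)) ⊘ P - R₂) * P * A ≡ (1ℚ + 1ℚ - A) * (S₁ + P * K₁) + (1ℚ + A) * (S₀ + P * K₀ - 1ℚ)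
    identity = trans
      (clear-denominators₂ (ι (u a (p ℕ.+ 1))) T (ι (a ℤ.+ + 1)) (ι ((a ℤ.+ + 1) ℤ.^ p′ ℤ.- + 1)) P≢0 (ι≢0 a p∤a))
      (numerator₂ {A} {P} {Y} {K₀} {K₁} {S₀} {S₁} {ι (u a (p ℕ.+ 1))} S₂≡
        (cong₂ (λ c₁ c₀ → c₁ * K₁ - c₀ * K₀) (ι-- a (+ 2)) (ι-+ a (+ 1))) (ι-+ a (+ 1)) ι[[a+1]^[p-1]-1]≡
        (subst (λ n → A * ι (u a n) ≡ (1ℚ - A) * S₁ - S₂ + A * S₀) (ℕP.+-comm 1 p) (proj₂ (a*u≡S a p))))
    combination : (P * P) ∣⟨ p ⟩ ((1ℚ + 1ℚ - A) * (S₁ + P * K₁) + (1ℚ + A) * (S₀ + P * K₀ - 1ℚ))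
    combination = ∣⟨⟩-+ p-prime
      (∣⟨⟩-*ˡ p-prime (1∣⟨⟩ (+ 2 ℤ.- a) (ι-- (+ 2) a)) (p²∣⟨⟩S₁+pK₁ p≡2))
      (∣⟨⟩-*ˡ p-prime (1∣⟨⟩ (+ 1 ℤ.+ a) (ι-+ (+ 1) a)) (p²∣⟨⟩S₀+pK₀-1 (λ p≡0 → 2≢0 (trans (sym p≡2) p≡0))))
      where
      2≢0 : 2 ≢ 0
      2≢0 ()

∤-*ʳ : ∀ {k} x y → ¬ (k ∣ x ℤ.* y) → ¬ (k ∣ y)
∤-*ʳ {k} x y k∤xy k∣y = k∤xy (ℤS.∣⇒∣ᵤ {k} (ℤS.∣n⇒∣m*n x (ℤS.∣ᵤ⇒∣ {k} k∣y)))

theorem4p3 : (a : ℤ) → (p : ℕ) →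
    a ≢ + 0 → a ≢ + 1 → a ≢ -[1+ 0 ] →
    Prime p → p ≢ 2 →
    ¬ (+ p ∣ (+ 3 ℤ.* a ℤ.* (a ℤ.^ 3 ℤ.+ + 1))) →
    (p % 3 ≡ 1 →
      (ι (u a (p ℕ.∸ 1)) ⊘ ι (+ p)) ≡
        (((ι (+ 2 ℤ.* a ℤ.- + 1) * K p 0 a + ι (a ℤ.- + 2) * K p 1 a)
            ⊘ ι (a ℤ.* (a ℤ.* a ℤ.- a ℤ.+ + 1)))
         - (ι (a ℤ.- + 2) ⊘ ι (a ℤ.* a ℤ.- a ℤ.+ + 1)) * q p a
         + (ι (a ℤ.* a ℤ.- + 1) ⊘ ι (a ℤ.* (a ℤ.* a ℤ.- a ℤ.+ + 1))) * q p (a ℤ.+ + 1))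
        [modℚ p ])
    × (p % 3 ≡ 2 →
      (ι (u a (p ℕ.+ 1)) ⊘ ι (+ p)) ≡
        (((ι (a ℤ.- + 2) * K p 1 a - ι (a ℤ.+ + 1) * K p 0 a) ⊘ ι a)
         - (ι (a ℤ.+ + 1) ⊘ ι a) * q p (a ℤ.+ + 1))
        [modℚ p ])
theorem4p3 a zero     _ _ _ p-prime _ _           = ⊥-elim (¬prime[0] p-prime)
theorem4p3 a (suc p′) _ _ _ p-prime _ p∤3a[a³+1] =
  (λ p≡1 → u[p-1]/p≡ a p-prime p∤a p≡1 p∤a²-a+1) , u[p+1]/p≡ a p-prime p∤a
  where
  p∤a : ¬ (+ suc p′ ∣ a)
  p∤a = ∤-*ʳ {+ suc p′} (+ 3 ℤ.* (a ℤ.^ 3 ℤ.+ + 1)) a (subst (λ z → ¬ (+ suc p′ ∣ z)) (factorisation a) p∤3a[a³+1])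
    where
    factorisation : ∀ a → + 3 ℤ.* a ℤ.* (a ℤ.* (a ℤ.* (a ℤ.* + 1)) ℤ.+ + 1)
                        ≡ + 3 ℤ.* (a ℤ.* (a ℤ.* (a ℤ.* + 1)) ℤ.+ + 1) ℤ.* a
    factorisation = ℤ-solve-∀
  p∤a²-a+1 : ¬ (+ suc p′ ∣ a ℤ.* a ℤ.- a ℤ.+ + 1)
  p∤a²-a+1 = ∤-*ʳ {+ suc p′} (+ 3 ℤ.* a ℤ.* (a ℤ.+ + 1)) (a ℤ.* a ℤ.- a ℤ.+ + 1)
    (subst (λ z → ¬ (+ suc p′ ∣ z)) (factorisation a) p∤3a[a³+1])
    where
    factorisation : ∀ a → + 3 ℤ.* a ℤ.* (a ℤ.* (a ℤ.* (a ℤ.* + 1)) ℤ.+ + 1)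
                        ≡ + 3 ℤ.* a ℤ.* (a ℤ.+ + 1) ℤ.* (a ℤ.* a ℤ.- a ℤ.+ + 1)
    factorisation = ℤ-solve-∀
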